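{- Let $p,q\in\mathbb{R}[x]$ be such that both $\mathscr{W}(p)$ and $\mathscr{W}(q)$ have only nonnegative coefficients and no internal zeros. Then $\mathscr{W}(pq)$ has no internal zeros.
   Context: For $p\in\mathbb{R}[x]$ of degree $d$, $\mathscr{W}(p)$ is the polynomial of degree at most $d$ defined by $\sum_{j\ge0}p(j)x^j=\mathscr{W}(p)(x)/(1-x)^{d+1}$. A polynomial $\sum_ja_jx^j$ has no internal zeros if there are no indices $i<j<k$ with $a_j=0$ and $a_ia_k\ne0$. -}

module Defs where

open import Level using (0ℓ)
open import Data.Nat as ℕ using (ℕ; zero; suc)
open import Data.Nat.Combinatorics using (_C_)
open import Data.Fin using (Fin)
open import Data.Vec using (Vec; lookup)
open import Data.Product using (Σ; ∃; _×_; _,_)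
open import Relation.Binary.PropositionalEquality using (_≡_)
open import Relation.Binary.Structures using (IsTotalOrder)
open import Relation.Nullary using (¬_)
import Relation.Nullary
import Data.Fin
import Data.Vec
open import Algebra.Structures using (IsCommutativeRing)

-- A model of the real numbers: a Dedekind-complete ordered field.
-- (All such models are isomorphic to ℝ, so quantifying over them is
-- quantifying over ℝ.)
record RealField : Set₁ where
  infixl 6 _+_
  infixl 7 _*_
  infix 4 _≤_
  field
    Carrier : Set
    _+_ _*_ : Carrier → Carrier → Carrier
    -_      : Carrier → Carrier
    0# 1#   : Carrier
    _≤_     : Carrier → Carrier → Set
    isCommutativeRing : IsCommutativeRing _≡_ _+_ _*_ -_ 0# 1#
    0≢1     : ¬ (0# ≡ 1#)
    inverse : ∀ x → ¬ (x ≡ 0#) → Σ Carrier (λ y → x * y ≡ 1#)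
    isTotalOrder : IsTotalOrder _≡_ _≤_
    +-mono-≤ : ∀ x y z → x ≤ y → x + z ≤ y + z
    *-nonneg : ∀ x y → 0# ≤ x → 0# ≤ y → 0# ≤ x * y
    complete : (P : Carrier → Set) → ∃ P →
               Σ Carrier (λ b → ∀ x → P x → x ≤ b) →
               Σ Carrier (λ s → (∀ x → P x → x ≤ s) ×
                                (∀ b → (∀ x → P x → x ≤ b) → s ≤ b))

module Poly (R : RealField) where
  open RealField R

  fromℕ : ℕ → Carrier
  fromℕ zero    = 0#
  fromℕ (suc n) = 1# + fromℕ n

  _^_ : Carrier → ℕ → Carrier
  x ^ zero  = 1#
  x ^ suc n = x * (x ^ n)

  sumTo : ℕ → (ℕ → Carrier) → Carrier
  sumTo zero    f = 0#
  sumTo (suc n) f = sumTo n f + f n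

  -- A polynomial of degree ≤ d is its vector of coefficients a₀,…,a_d
  -- (constant term first).  coeff extends by 0 beyond the degree.
  coeff : ∀ {d} → Vec Carrier (suc d) → ℕ → Carrier
  coeff {d} a i with i ℕ.<? suc d
  ... | Relation.Nullary.yes i<d = lookup a (Data.Fin.fromℕ< i<d)
  ... | Relation.Nullary.no _    = 0#

  HasDegree : ∀ d → Vec Carrier (suc d) → Set
  HasDegree d a = ¬ (coeff a d ≡ 0#)

  evalℕ : ∀ {d} → Vec Carrier (suc d) → ℕ → Carrier
  evalℕ {d} a j = sumTo (suc d) (λ i → coeff a i * (fromℕ j ^ i))

  _⊛_ : ∀ {d e} → Vec Carrier (suc d) → Vec Carrier (suc e) → Vec Carrier (suc (d ℕ.+ e))
  _⊛_ {d} {e} a b = Data.Vec.tabulate (λ k →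
      sumTo (suc (Data.Fin.toℕ k)) (λ i → coeff a i * coeff b (Data.Fin.toℕ k ℕ.∸ i)))

  -- IsW d p w : w (of degree ≤ d) is 𝒲(p) for the polynomial p of degree d, i.e.
  --   Σ_{j≥0} p(j) x^j = w(x) / (1-x)^{d+1}
  -- compared coefficientwise, using 1/(1-x)^{d+1} = Σ_m C(m+d, d) x^m:
  --   p(j) = Σ_{k ≤ j} w_k · C(j - k + d, d).
  IsW : ∀ d → Vec Carrier (suc d) → Vec Carrier (suc d) → Set
  IsW d p w = ∀ j → evalℕ p j ≡
    sumTo (suc j) (λ k → coeff w k * fromℕ (((j ℕ.∸ k) ℕ.+ d) C d))

  Nonnegative : ∀ {d} → Vec Carrier (suc d) → Set
  Nonnegative w = ∀ i → 0# ≤ coeff w i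

  NoInternalZeros : ∀ {d} → Vec Carrier (suc d) → Set
  NoInternalZeros w = ¬ (Σ ℕ λ i → Σ ℕ λ j → Σ ℕ λ k →
    (i ℕ.< j) × (j ℕ.< k) × (coeff w j ≡ 0#) × ¬ (coeff w i ≡ 0#) × ¬ (coeff w k ≡ 0#))

-- Write b^D_k(x) = C(x - k + D, D). The definition of 𝒲 says p = ∑_k 𝒲(p)_k b^d_k on the
-- naturals. A product of basis polynomials expands with nonnegative integer coefficients,
--   b^d_i b^e_l = ∑_k C(d - i + l, k - i) C(e - l + i, k - l) b^{d+e}_k,
-- (an identity proved by induction through Pascal's rule), so 𝒲(pq)_k is a sum of nonnegative
-- terms 𝒲(p)_i 𝒲(q)_l C(d - i + l, k - i) C(e - l + i, k - l); for 𝒲(p)_i 𝒲(q)_l ≠ 0 the term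
-- is nonzero exactly for k in the interval [max(i, l), min(d + l, e + i)]. The supports of 𝒲(p)
-- and 𝒲(q) are intervals, and moving i or l by one moves the ends of that interval by at most
-- one, so walking from a pair covering I to a pair covering K cannot jump over an index J
-- between them: 𝒲(pq) has no internal zeros.
module Submission where

open import Defs

import Level
open import Algebra.Bundles using (CommutativeRing; CommutativeSemigroup)
open import Algebra.Structures using (IsCommutativeSemiring; IsCommutativeRing)
import Algebra.Properties.CommutativeSemigroup as CommutativeSemigroupProperties
import Algebra.Properties.Ring as RingProperties
open import Data.Empty using (⊥)
import Data.Fin as Fin
open import Data.Fin.Properties using (toℕ-fromℕ<)
open import Data.Maybe using (nothing)
open import Data.Nat.Combinatorics using (_C_; nCn≡1)
open import Data.Nat as ℕ using (ℕ; zero; suc; z≤n; s≤s)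
import Data.Nat.Properties as ℕ
open import Data.Product using (Σ; _×_; _,_)
open import Data.Sum using (_⊎_; inj₁; inj₂)
open import Data.Vec using (Vec; lookup)
open import Data.Vec.Properties using (lookup∘tabulate)
open import Function using (_∘_; _⇔_; mk⇔; Equivalence)
open import Relation.Binary.Definitions using (tri<; tri≈; tri>)
open import Relation.Binary.Structures using (IsTotalOrder)
open import Relation.Binary.PropositionalEquality
open import Relation.Nullary using (¬_; yes; no; contradiction)

module FiniteSum {A : Set} {plus times : A → A → A} {0# 1# : A}
                 (isCommutativeSemiring : IsCommutativeSemiring _≡_ plus times 0# 1#) where

  open IsCommutativeSemiring isCommutativeSemiring hiding (refl; sym; trans)

  private
    -- Module parameters cannot be given fixities.
    infixl 6 _+_
    infixl 7 _*_
    _+_ _*_ : A → A → A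
    _+_ = plus
    _*_ = times

    +-commutativeSemigroup : CommutativeSemigroup _ _
    +-commutativeSemigroup = record { isCommutativeSemigroup = +-isCommutativeSemigroup }

  open CommutativeSemigroupProperties +-commutativeSemigroup using (interchange)
  open ≡-Reasoning

  ∑ : ℕ → (ℕ → A) → A
  ∑ zero    f = 0#
  ∑ (suc n) f = ∑ n f + f n

  infixl 10 ∑
  syntax ∑ n (λ k → e) = ∑[ k < n ] e

  ∑-cong : ∀ n {f g} → (∀ k → k ℕ.< n → f k ≡ g k) → ∑ n f ≡ ∑ n g
  ∑-cong zero    f≗g = refl
  ∑-cong (suc n) f≗g = cong₂ _+_ (∑-cong n (λ k k<n → f≗g k (ℕ.m<n⇒m<1+n k<n))) (f≗g n ℕ.≤-refl)

  ∑-zero : ∀ n {f} → (∀ k → k ℕ.< n → f k ≡ 0#) → ∑ n f ≡ 0#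
  ∑-zero n f≗0 = trans (∑-cong n f≗0) (zeros n)
    where
      zeros : ∀ n → ∑[ k < n ] 0# ≡ 0#
      zeros zero    = refl
      zeros (suc n) = trans (+-identityʳ _) (zeros n)

  ∑-distrib-+ : ∀ n f g → ∑[ k < n ] (f k + g k) ≡ ∑ n f + ∑ n g
  ∑-distrib-+ zero    f g = sym (+-identityˡ 0#)
  ∑-distrib-+ (suc n) f g = trans (cong (_+ (f n + g n)) (∑-distrib-+ n f g)) (interchange (∑ n f) (∑ n g) (f n) (g n))

  *-distribˡ-∑ : ∀ n c f → c * ∑ n f ≡ ∑[ k < n ] (c * f k)
  *-distribˡ-∑ zero    c f = zeroʳ c
  *-distribˡ-∑ (suc n) c f = trans (distribˡ c (∑ n f) (f n)) (cong (_+ (c * f n)) (*-distribˡ-∑ n c f))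

  *-distribʳ-∑ : ∀ n c f → ∑ n f * c ≡ ∑[ k < n ] (f k * c)
  *-distribʳ-∑ n c f = begin
    ∑ n f * c            ≡⟨ *-comm (∑ n f) c ⟩
    c * ∑ n f            ≡⟨ *-distribˡ-∑ n c f ⟩
    ∑[ k < n ] (c * f k) ≡⟨ ∑-cong n (λ k _ → *-comm c (f k)) ⟩
    ∑[ k < n ] (f k * c) ∎

  ∑*∑ : ∀ m n f g → ∑ m f * ∑ n g ≡ ∑[ i < m ] ∑[ j < n ] (f i * g j)
  ∑*∑ m n f g = trans (*-distribʳ-∑ m (∑ n g) f) (∑-cong m (λ i _ → *-distribˡ-∑ n (f i) g))

  ∑-head : ∀ n f → ∑ (suc n) f ≡ f 0 + ∑[ k < n ] f (suc k)
  ∑-head zero    f = trans (+-identityˡ (f 0)) (sym (+-identityʳ (f 0)))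
  ∑-head (suc n) f = trans (cong (_+ f (suc n)) (∑-head n f)) (+-assoc (f 0) _ _)

  ∑-truncate : ∀ m n f → (∀ k → m ℕ.≤ k → f k ≡ 0#) → m ℕ.≤ n → ∑ n f ≡ ∑ m f
  ∑-truncate m zero    f vanish z≤n = refl
  ∑-truncate m (suc n) f vanish m≤1+n with ℕ.m≤n⇒m<n∨m≡n m≤1+n
  ... | inj₂ refl  = refl
  ... | inj₁ m<1+n = begin
    ∑ n f + f n ≡⟨ cong₂ _+_ (∑-truncate m n f vanish (ℕ.≤-pred m<1+n)) (vanish n (ℕ.≤-pred m<1+n)) ⟩
    ∑ m f + 0#  ≡⟨ +-identityʳ _ ⟩
    ∑ m f       ∎

  ∑-comm : ∀ m n (f : ℕ → ℕ → A) → ∑[ i < m ] ∑[ j < n ] f i j ≡ ∑[ j < n ] ∑[ i < m ] f i j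
  ∑-comm zero    n f = sym (∑-zero n (λ _ _ → refl))
  ∑-comm (suc m) n f = begin
    ∑[ i < m ] ∑[ j < n ] f i j + ∑[ j < n ] f m j ≡⟨ cong (_+ ∑[ j < n ] f m j) (∑-comm m n f) ⟩
    ∑[ j < n ] ∑[ i < m ] f i j + ∑[ j < n ] f m j ≡⟨ sym (∑-distrib-+ n _ _) ⟩
    ∑[ j < n ] ∑[ i < suc m ] f i j                ∎

  ∑-single : ∀ n {f} l → (∀ k → k ℕ.< n → k ≢ l → f k ≡ 0#) → l ℕ.< n → ∑ n f ≡ f l
  ∑-single (suc n) {f} l others l<1+n with l ℕ.≟ n
  ... | yes refl = begin
    ∑ l f + f l ≡⟨ cong (_+ f l) (∑-zero l (λ k k<l → others k (ℕ.m<n⇒m<1+n k<l) (ℕ.<⇒≢ k<l))) ⟩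
    0# + f l    ≡⟨ +-identityˡ _ ⟩
    f l         ∎
  ... | no l≢n = begin
    ∑ n f + f n ≡⟨ cong₂ _+_ (∑-single n l (λ k k<n → others k (ℕ.m<n⇒m<1+n k<n)) (ℕ.≤∧≢⇒< (ℕ.≤-pred l<1+n) l≢n))
                             (others n ℕ.≤-refl (l≢n ∘ sym)) ⟩
    f l + 0#    ≡⟨ +-identityʳ _ ⟩
    f l         ∎

module Binomial where

  open import Data.Nat using (_+_; _*_; _∸_; _≤_; _<_)
  open import Data.Nat.Tactic.RingSolver using (solve-∀)
  open import Data.Nat.Combinatorics using (nCk≡nC[n∸k]; k>n⇒nCk≡0; nCk+nC[k+1]≡[n+1]C[k+1])
  open FiniteSum ℕ.+-*-isCommutativeSemiring public
  open ≡-Reasoning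

  -- Defined by Pascal's rule so that it computes by pattern matching, unlike _C_.
  binomial : ℕ → ℕ → ℕ
  binomial n       zero    = 1
  binomial zero    (suc k) = 0
  binomial (suc n) (suc k) = binomial n k + binomial n (suc k)

  binomial≡C : ∀ n k → binomial n k ≡ n C k
  binomial≡C n       zero    = sym (trans (nCk≡nC[n∸k] {n = n} z≤n) (nCn≡1 n))
  binomial≡C zero    (suc k) = sym (k>n⇒nCk≡0 {0} {suc k} (s≤s z≤n))
  binomial≡C (suc n) (suc k) = trans (cong₂ _+_ (binomial≡C n k) (binomial≡C n (suc k))) (nCk+nC[k+1]≡[n+1]C[k+1] n k)

  binomial-> : ∀ {n k} → n < k → binomial n k ≡ 0
  binomial-> {zero}  {suc k} _         = refl
  binomial-> {suc n} {suc k} (s≤s n<k) = cong₂ _+_ (binomial-> n<k) (binomial-> (ℕ.m<n⇒m<1+n n<k))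

  binomial-diag : ∀ n → binomial n n ≡ 1
  binomial-diag zero    = refl
  binomial-diag (suc n) = cong₂ _+_ (binomial-diag n) (binomial-> (ℕ.n<1+n n))

  binomial>0 : ∀ {n k} → k ≤ n → 0 < binomial n k
  binomial>0 {n}     {zero}  _         = s≤s z≤n
  binomial>0 {suc n} {suc k} (s≤s k≤n) = ℕ.≤-trans (binomial>0 k≤n) (ℕ.m≤m+n _ _)

  binomial>0⇒≤ : ∀ n k → 0 < binomial n k → k ≤ n
  binomial>0⇒≤ n k 0<C with k ℕ.≤? n
  ... | yes k≤n = k≤n
  ... | no  k≰n = contradiction (binomial-> (ℕ.≰⇒> k≰n)) (ℕ.>⇒≢ 0<C)

  -- shiftedBinomial m k i is C(m, k ∸ i) for i ≤ k, and 0 for k < i.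
  shiftedBinomial : ℕ → ℕ → ℕ → ℕ
  shiftedBinomial m k       zero    = binomial m k
  shiftedBinomial m zero    (suc i) = 0
  shiftedBinomial m (suc k) (suc i) = shiftedBinomial m k i

  shiftedBinomial-pascal : ∀ m k i → shiftedBinomial (suc m) k i ≡ shiftedBinomial m k i + shiftedBinomial m k (suc i)
  shiftedBinomial-pascal m zero    zero    = refl
  shiftedBinomial-pascal m (suc k) zero    = ℕ.+-comm (binomial m k) (binomial m (suc k))
  shiftedBinomial-pascal m zero    (suc i) = refl
  shiftedBinomial-pascal m (suc k) (suc i) = shiftedBinomial-pascal m k i

  shiftedBinomial-< : ∀ m {k i} → k < i → shiftedBinomial m k i ≡ 0
  shiftedBinomial-< m {zero}  {suc i} _         = refl
  shiftedBinomial-< m {suc k} {suc i} (s≤s k<i) = shiftedBinomial-< m k<i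

  shiftedBinomial-diag : ∀ m i → shiftedBinomial m i i ≡ 1
  shiftedBinomial-diag m zero    = refl
  shiftedBinomial-diag m (suc i) = shiftedBinomial-diag m i

  shiftedBinomial>0 : ∀ m {k i} → i ≤ k → k ≤ i + m → 0 < shiftedBinomial m k i
  shiftedBinomial>0 m {k}     {zero}  _         k≤m       = binomial>0 k≤m
  shiftedBinomial>0 m {suc k} {suc i} (s≤s i≤k) (s≤s k≤i+m) = shiftedBinomial>0 m i≤k k≤i+m

  shiftedBinomial>0⇒ : ∀ m k i → 0 < shiftedBinomial m k i → i ≤ k × k ≤ i + m
  shiftedBinomial>0⇒ m k       zero    0<C = z≤n , binomial>0⇒≤ m k 0<C
  shiftedBinomial>0⇒ m (suc k) (suc i) 0<C with shiftedBinomial>0⇒ m k i 0<C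
  ... | i≤k , k≤i+m = s≤s i≤k , s≤s k≤i+m

  productCoefficient : ℕ → ℕ → ℕ → ℕ → ℕ → ℕ
  productCoefficient α i β l k = shiftedBinomial (l + α) k i * shiftedBinomial (β + i) k l

  productCoefficient-<ˡ : ∀ α {i} β l {k} → k < i → productCoefficient α i β l k ≡ 0
  productCoefficient-<ˡ α β l k<i rewrite shiftedBinomial-< (l + α) k<i = refl

  productCoefficient-<ʳ : ∀ α i β {l k} → k < l → productCoefficient α i β l k ≡ 0
  productCoefficient-<ʳ α i β {l} {k} k<l rewrite shiftedBinomial-< (β + i) k<l =
    ℕ.*-zeroʳ (shiftedBinomial (l + α) k i)

  -- For k ≤ n, the value at n of the k-th basis polynomial C(x - k + D, D) of degree D.
  basisValue : ℕ → ℕ → ℕ → ℕ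
  basisValue D n k = binomial (D + (n ∸ k)) D

  -- For α = d ∸ i and i ≤ n the first factor is basisValue d n i (likewise the second with β);
  -- parametrising by α and β keeps truncated subtraction out of the induction.
  BasisProduct : ℕ → ℕ → ℕ → ℕ → ℕ → Set
  BasisProduct α i β l n =
    binomial (α + n) (i + α) * binomial (β + n) (l + β) ≡
    ∑[ k < suc n ] (productCoefficient α i β l k * basisValue ((l + β) + (i + α)) n k)

  basisProduct-origin : ∀ β l n → BasisProduct 0 0 β l n
  basisProduct-origin β l n with l ℕ.≤? n
  ... | yes l≤n = begin
    1 * binomial (β + n) (l + β)                  ≡⟨ ℕ.*-identityˡ _ ⟩
    binomial (β + n) (l + β)                       ≡⟨ sym value ⟩
    basisValue D n l                               ≡⟨ sym (trans (cong (_* basisValue D n l) coefficient) (ℕ.*-identityˡ _)) ⟩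
    productCoefficient 0 0 β l l * basisValue D n l ≡⟨ sym (∑-single (suc n) l others (s≤s l≤n)) ⟩
    ∑[ k < suc n ] (productCoefficient 0 0 β l k * basisValue D n k) ∎
    where
      D : ℕ
      D = (l + β) + 0
      value : basisValue D n l ≡ binomial (β + n) (l + β)
      value rewrite ℕ.+-identityʳ (l + β) = cong (λ m → binomial m (l + β)) (begin
        (l + β) + (n ∸ l) ≡⟨ cong (_+ (n ∸ l)) (ℕ.+-comm l β) ⟩
        (β + l) + (n ∸ l) ≡⟨ ℕ.+-assoc β l (n ∸ l) ⟩
        β + (l + (n ∸ l)) ≡⟨ cong (β +_) (ℕ.m+[n∸m]≡n l≤n) ⟩
        β + n             ∎)
      coefficient : productCoefficient 0 0 β l l ≡ 1
      coefficient = cong₂ _*_ (trans (cong (λ m → binomial m l) (ℕ.+-identityʳ l)) (binomial-diag l))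
                              (shiftedBinomial-diag (β + 0) l)
      others : ∀ k → k < suc n → k ≢ l → productCoefficient 0 0 β l k * basisValue D n k ≡ 0
      others k _ k≢l with ℕ.<-cmp k l
      ... | tri< k<l _ _ = cong (_* basisValue D n k) (productCoefficient-<ʳ 0 0 β k<l)
      ... | tri≈ _ k≡l _ = contradiction k≡l k≢l
      ... | tri> _ _ l<k = cong (λ c → c * shiftedBinomial (β + 0) k l * basisValue D n k)
                                (binomial-> (subst (_< k) (sym (ℕ.+-identityʳ l)) l<k))
  ... | no l≰n = begin
    1 * binomial (β + n) (l + β) ≡⟨ cong (1 *_) (binomial-> β+n<l+β) ⟩
    0                            ≡⟨ sym (∑-zero (suc n) vanish) ⟩
    ∑[ k < suc n ] (productCoefficient 0 0 β l k * basisValue ((l + β) + 0) n k) ∎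
    where
      n<l : n < l
      n<l = ℕ.≰⇒> l≰n
      β+n<l+β : β + n < l + β
      β+n<l+β = subst (β + n <_) (ℕ.+-comm β l) (ℕ.+-monoʳ-< β n<l)
      vanish : ∀ k → k < suc n → productCoefficient 0 0 β l k * basisValue ((l + β) + 0) n k ≡ 0
      vanish k (s≤s k≤n) = cong (_* basisValue ((l + β) + 0) n k) (productCoefficient-<ʳ 0 0 β (ℕ.≤-<-trans k≤n n<l))

  basisProduct-sym : ∀ α i β l n → BasisProduct α i β l n → BasisProduct β l α i n
  basisProduct-sym α i β l n eq = begin
    binomial (β + n) (l + β) * binomial (α + n) (i + α) ≡⟨ ℕ.*-comm (binomial (β + n) (l + β)) _ ⟩
    binomial (α + n) (i + α) * binomial (β + n) (l + β) ≡⟨ eq ⟩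
    ∑[ k < suc n ] (productCoefficient α i β l k * basisValue ((l + β) + (i + α)) n k) ≡⟨ ∑-cong (suc n) swap ⟩
    ∑[ k < suc n ] (productCoefficient β l α i k * basisValue ((i + α) + (l + β)) n k) ∎
    where
      swap : ∀ k → k < suc n → productCoefficient α i β l k * basisValue ((l + β) + (i + α)) n k
                              ≡ productCoefficient β l α i k * basisValue ((i + α) + (l + β)) n k
      swap k _ = cong₂ _*_
        (trans (ℕ.*-comm (shiftedBinomial (l + α) k i) _)
               (cong₂ (λ a b → shiftedBinomial a k l * shiftedBinomial b k i) (ℕ.+-comm β i) (ℕ.+-comm l α)))
        (cong (λ D → basisValue D n k) (ℕ.+-comm (l + β) (i + α)))

  basisProduct-zero : ∀ α i β l → BasisProduct α (suc i) β (suc l) 0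
  basisProduct-zero α i β l = cong (_* binomial (β + 0) (suc l + β)) (binomial-> α+0<1+i+α)
    where
      α+0<1+i+α : α + 0 < suc (i + α)
      α+0<1+i+α = s≤s (subst (_≤ i + α) (sym (ℕ.+-identityʳ α)) (ℕ.m≤n+m α i))

  basisProduct-suc : ∀ α i β l n → BasisProduct (suc α) i (suc β) l n → BasisProduct α (suc i) β (suc l) (suc n)
  basisProduct-suc α i β l n eq = begin
    binomial (α + suc n) (suc i + α) * binomial (β + suc n) (suc l + β)
      ≡⟨ cong₂ _*_ (cong₂ binomial (ℕ.+-suc α n) (sym (ℕ.+-suc i α))) (cong₂ binomial (ℕ.+-suc β n) (sym (ℕ.+-suc l β))) ⟩
    binomial (suc α + n) (i + suc α) * binomial (suc β + n) (l + suc β)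
      ≡⟨ eq ⟩
    ∑[ k < suc n ] (productCoefficient (suc α) i (suc β) l k * basisValue ((l + suc β) + (i + suc α)) n k)
      ≡⟨ ∑-cong (suc n) shift ⟩
    ∑[ k < suc n ] (productCoefficient α (suc i) β (suc l) (suc k) * basisValue ((suc l + β) + (suc i + α)) (suc n) (suc k))
      ≡⟨ sym (∑-head (suc n) _) ⟩
    ∑[ k < suc (suc n) ] (productCoefficient α (suc i) β (suc l) k * basisValue ((suc l + β) + (suc i + α)) (suc n) k) ∎
    where
      shift : ∀ k → k < suc n →
        productCoefficient (suc α) i (suc β) l k * basisValue ((l + suc β) + (i + suc α)) n k ≡
        productCoefficient α (suc i) β (suc l) (suc k) * basisValue ((suc l + β) + (suc i + α)) (suc n) (suc k)
      shift k _ = cong₂ _*_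
        (cong₂ (λ a b → shiftedBinomial a k i * shiftedBinomial b k l) (ℕ.+-suc l α) (sym (ℕ.+-suc β i)))
        (cong (λ D → basisValue D n k) (cong₂ _+_ (ℕ.+-suc l β) (ℕ.+-suc i α)))

  -- Pascal's rule on both sides; with V′ = V + Z, the surplus ∑ s · V′ on the right equals the
  -- surplus ∑ c₀ · Z on the left.
  basisProduct-pascal : ∀ α i β n → BasisProduct α i β 1 n → BasisProduct α i β 0 n → BasisProduct α i (suc β) 0 n
  basisProduct-pascal α i β n eq₁ eq₀ = ℕ.+-cancelʳ-≡ (∑ (suc n) (λ k → s k * V′ k)) _ _ (begin
    A * (P + Q) + ∑[ k < suc n ] (s k * V′ k)
      ≡⟨ cong (_+ ∑[ k < suc n ] (s k * V′ k)) (trans (ℕ.*-distribˡ-+ A P Q) (cong₂ _+_ eq₀ eq₁)) ⟩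
    ∑[ k < suc n ] (c₀ k * V k) + ∑[ k < suc n ] (c₁ k * V′ k) + ∑[ k < suc n ] (s k * V′ k)
      ≡⟨ trans (ℕ+.xy∙z≈xz∙y (∑[ k < suc n ] (c₀ k * V k)) _ _)
               (cong (λ x → ∑[ k < suc n ] (c₀ k * V k) + x + ∑[ k < suc n ] (c₁ k * V′ k)) shift) ⟩
    ∑[ k < suc n ] (c₀ k * V k) + ∑[ k < suc n ] (c₀ k * Z k) + ∑[ k < suc n ] (c₁ k * V′ k)
      ≡⟨ cong (_+ ∑[ k < suc n ] (c₁ k * V′ k)) (sym (∑-distrib-+ (suc n) _ _)) ⟩
    ∑[ k < suc n ] (c₀ k * V k + c₀ k * Z k) + ∑[ k < suc n ] (c₁ k * V′ k)
      ≡⟨ cong (_+ ∑[ k < suc n ] (c₁ k * V′ k)) (∑-cong (suc n) (λ k _ → sym (ℕ.*-distribˡ-+ (c₀ k) (V k) (Z k)))) ⟩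
    ∑[ k < suc n ] (c₀ k * V′ k) + ∑[ k < suc n ] (c₁ k * V′ k)
      ≡⟨ sym (∑-distrib-+ (suc n) _ _) ⟩
    ∑[ k < suc n ] (c₀ k * V′ k + c₁ k * V′ k)
      ≡⟨ ∑-cong (suc n) (λ k _ → coefficients-pascal k) ⟩
    ∑[ k < suc n ] (c k * V′ k + s k * V′ k)
      ≡⟨ ∑-distrib-+ (suc n) _ _ ⟩
    ∑[ k < suc n ] (c k * V′ k) + ∑[ k < suc n ] (s k * V′ k) ∎)
    where
      module ℕ+ = CommutativeSemigroupProperties ℕ.+-commutativeSemigroup
      m A P Q : ℕ
      m = β + (i + α)
      A = binomial (α + n) (i + α)
      P = binomial (β + n) β
      Q = binomial (β + n) (suc β)
      V V′ Z c c₀ c₁ s : ℕ → ℕ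
      V  k = basisValue m n k
      V′ k = basisValue (suc m) n k
      Z  k = binomial (m + (n ∸ k)) (suc m)
      c  k = productCoefficient α i (suc β) 0 k
      c₀ k = productCoefficient α i β 0 k
      c₁ k = productCoefficient α i β 1 k
      s  k = shiftedBinomial α k (suc i) * shiftedBinomial (β + i) k 1

      -- s is c₀ shifted by one place, and V′ (suc k) = Z k.
      shift : ∑[ k < suc n ] (s k * V′ k) ≡ ∑[ k < suc n ] (c₀ k * Z k)
      shift = begin
        ∑[ k < suc n ] (s k * V′ k)     ≡⟨ ∑-head n _ ⟩
        ∑[ k < n ] (c₀ k * V′ (suc k))  ≡⟨ ∑-cong n (λ k k<n → cong (λ x → c₀ k * binomial x (suc m)) (index k<n)) ⟩
        ∑[ k < n ] (c₀ k * Z k)         ≡⟨ sym (∑-truncate n (suc n) _ (λ k n≤k → trans (cong (c₀ k *_) (Z-vanishes n≤k)) (ℕ.*-zeroʳ (c₀ k)))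
                                                                (ℕ.n≤1+n n)) ⟩
        ∑[ k < suc n ] (c₀ k * Z k)     ∎
        where
          index : ∀ {k} → k < n → suc m + (n ∸ suc k) ≡ m + (n ∸ k)
          index k<n = trans (sym (ℕ.+-suc m _)) (cong (m +_) (sym (ℕ.+-∸-assoc 1 k<n)))
          Z-vanishes : ∀ {k} → n ≤ k → Z k ≡ 0
          Z-vanishes n≤k rewrite ℕ.m≤n⇒m∸n≡0 n≤k = binomial-> (s≤s (ℕ.≤-reflexive (ℕ.+-identityʳ m)))

      coefficients-pascal : ∀ k → c₀ k * V′ k + c₁ k * V′ k ≡ c k * V′ k + s k * V′ k
      coefficients-pascal k = begin
        c₀ k * V′ k + c₁ k * V′ k ≡⟨ sym (ℕ.*-distribʳ-+ (V′ k) (c₀ k) (c₁ k)) ⟩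
        (c₀ k + c₁ k) * V′ k      ≡⟨ cong (_* V′ k) coefficients ⟩
        (c k + s k) * V′ k        ≡⟨ ℕ.*-distribʳ-+ (V′ k) (c k) (s k) ⟩
        c k * V′ k + s k * V′ k   ∎
        where
          a a′ b b′ : ℕ
          a = shiftedBinomial α k i
          a′ = shiftedBinomial α k (suc i)
          b = shiftedBinomial (β + i) k 0
          b′ = shiftedBinomial (β + i) k 1
          regroup : ∀ x x′ y y′ → x * y + (x + x′) * y′ ≡ x * (y + y′) + x′ * y′
          regroup = solve-∀
          coefficients : c₀ k + c₁ k ≡ c k + s k
          coefficients = begin
            a * b + shiftedBinomial (suc α) k i * b′ ≡⟨ cong (λ x → a * b + x * b′) (shiftedBinomial-pascal α k i) ⟩
            a * b + (a + a′) * b′                   ≡⟨ regroup a a′ b b′ ⟩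
            a * (b + b′) + a′ * b′                  ≡⟨ cong (λ x → a * x + s k) (sym (shiftedBinomial-pascal (β + i) k 0)) ⟩
            c k + s k                               ∎

  basisProduct : ∀ α i β l n → BasisProduct α i β l n
  basisProduct α i β l n = bounded n (α + β) α β i l ℕ.≤-refl
    where
      -- Recursion on n, and for fixed n on the bound s of α + β.
      bounded : ∀ n s α β i l → α + β ≤ s → BasisProduct α i β l n
      bounded n       s       zero    β       zero    l       _   = basisProduct-origin β l n
      bounded n       s       α       zero    i       zero    _   = basisProduct-sym 0 0 α i n (basisProduct-origin α i n)
      bounded zero    s       α       β       (suc i) (suc l) _   = basisProduct-zero α i β l
      bounded (suc n) s       α       β       (suc i) (suc l) _   =
        basisProduct-suc α i β l n (bounded n (suc α + suc β) (suc α) (suc β) i l ℕ.≤-refl)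
      bounded n       (suc s) α       (suc β) i       zero    α+β<s =
        basisProduct-pascal α i β n (bounded n s α β i 1 α+β≤s) (bounded n s α β i 0 α+β≤s)
        where
          α+β≤s : α + β ≤ s
          α+β≤s = ℕ.≤-pred (subst (_≤ suc s) (ℕ.+-suc α β) α+β<s)
      bounded n       (suc s) (suc α) β       zero    (suc l) α+β<s =
        basisProduct-sym β (suc l) (suc α) 0 n
          (basisProduct-pascal β (suc l) α n (bounded n s β α (suc l) 1 β+α≤s) (bounded n s β α (suc l) 0 β+α≤s))
        where
          β+α≤s : β + α ≤ s
          β+α≤s = subst (_≤ s) (ℕ.+-comm α β) (ℕ.≤-pred α+β<s)
      bounded n       zero    α       (suc β) i       zero    α+β≤0 = contradiction (subst (_≤ 0) (ℕ.+-suc α β) α+β≤0) λ ()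
      bounded n       zero    (suc α) β       zero    (suc l) ()

module Convex where

  open import Data.Nat using (_≤_)
  open import Function.Properties.Equivalence using (⇔-isEquivalence)
  open import Relation.Binary.Structures using (IsEquivalence)
  open IsEquivalence (⇔-isEquivalence {Level.zero}) using () renaming (refl to ⇔-refl; trans to ⇔-trans)

  Convex : (ℕ → Set) → Set
  Convex G = ∀ {x m y} → G x → G y → x ≤ m → m ≤ y → G m

  module _ {G P : ℕ → Set} (convex : Convex G) (step : ∀ {m} → G m → G (suc m) → P m ⇔ P (suc m)) where

    ⇔-along : ∀ {x} y → x ≤ y → G x → G y → P x ⇔ P y
    ⇔-along zero    z≤n      _  _  = ⇔-refl
    ⇔-along (suc y) x≤1+y gx g1+y with ℕ.m≤n⇒m<n∨m≡n x≤1+y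
    ... | inj₂ refl      = ⇔-refl
    ... | inj₁ (s≤s x≤y) = ⇔-trans (⇔-along y x≤y gx gy) (step gy g1+y)
      where
        gy : G y
        gy = convex gx g1+y x≤y (ℕ.n≤1+n y)

    transport : ∀ {x y} → G x → G y → P x → P y
    transport {x} {y} gx gy with ℕ.≤-total x y
    ... | inj₁ x≤y = Equivalence.to (⇔-along y x≤y gx gy)
    ... | inj₂ y≤x = Equivalence.from (⇔-along x y≤x gy gx)

module Covering (d e : ℕ) where

  open import Data.Nat using (_+_; _∸_; _≤_; _<_)
  open Binomial using (productCoefficient; shiftedBinomial; shiftedBinomial>0; shiftedBinomial>0⇒)
  open Convex

  -- For i ≤ d and l ≤ e these are the k with productCoefficient (d ∸ i) i (e ∸ l) l k ≠ 0.
  Covers : ℕ → ℕ → ℕ → Set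
  Covers i l k = i ≤ k × l ≤ k × k ≤ d + l × k ≤ e + i

  -- Everything covered by (i, l) lies below k.
  Below : ℕ → ℕ → ℕ → Set
  Below i l k = d + l < k ⊎ e + i < k

  private
    m+[o+[n∸m]]≡n+o : ∀ {m n} o → m ≤ n → m + (o + (n ∸ m)) ≡ n + o
    m+[o+[n∸m]]≡n+o {m} {n} o m≤n = begin
      m + (o + (n ∸ m)) ≡⟨ cong (m +_) (ℕ.+-comm o (n ∸ m)) ⟩
      m + ((n ∸ m) + o) ≡⟨ sym (ℕ.+-assoc m (n ∸ m) o) ⟩
      (m + (n ∸ m)) + o ≡⟨ cong (_+ o) (ℕ.m+[n∸m]≡n m≤n) ⟩
      n + o             ∎
      where open ≡-Reasoning

    m+[[n∸m]+o]≡n+o : ∀ {m n} o → m ≤ n → m + ((n ∸ m) + o) ≡ n + o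
    m+[[n∸m]+o]≡n+o {m} {n} o m≤n = trans (cong (m +_) (ℕ.+-comm (n ∸ m) o)) (m+[o+[n∸m]]≡n+o o m≤n)

  productCoefficient>0⇒Covers : ∀ {i l k} → i ≤ d → l ≤ e → 0 < productCoefficient (d ∸ i) i (e ∸ l) l k → Covers i l k
  productCoefficient>0⇒Covers {i} {l} {k} i≤d l≤e c>0
    with shiftedBinomial>0⇒ _ k i (ℕ.>-nonZero⁻¹ _ {{ℕ.m*n≢0⇒m≢0 _ {{ℕ.>-nonZero c>0}}}})
       | shiftedBinomial>0⇒ _ k l (ℕ.>-nonZero⁻¹ _ {{ℕ.m*n≢0⇒n≢0 (shiftedBinomial (l + (d ∸ i)) k i) {{ℕ.>-nonZero c>0}}}})
  ... | i≤k , k≤i+[l+[d∸i]] | l≤k , k≤l+[[e∸l]+i] =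
    i≤k , l≤k , subst (k ≤_) (m+[o+[n∸m]]≡n+o l i≤d) k≤i+[l+[d∸i]]
              , subst (k ≤_) (m+[[n∸m]+o]≡n+o i l≤e) k≤l+[[e∸l]+i]

  Covers⇒productCoefficient>0 : ∀ {i l k} → i ≤ d → l ≤ e → Covers i l k → 0 < productCoefficient (d ∸ i) i (e ∸ l) l k
  Covers⇒productCoefficient>0 {i} {l} {k} i≤d l≤e (i≤k , l≤k , k≤d+l , k≤e+i) = ℕ.*-mono-≤
    (shiftedBinomial>0 _ i≤k (subst (k ≤_) (sym (m+[o+[n∸m]]≡n+o l i≤d)) k≤d+l))
    (shiftedBinomial>0 _ l≤k (subst (k ≤_) (sym (m+[[n∸m]+o]≡n+o i l≤e)) k≤e+i))

  private
    Below⇒< : ∀ {i l J} → i ≤ d → l ≤ e → Below i l J → i < J × l < J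
    Below⇒< {i} {l} i≤d l≤e (inj₁ d+l<J) = ℕ.≤-<-trans (ℕ.≤-trans i≤d (ℕ.m≤m+n d l)) d+l<J , ℕ.≤-<-trans (ℕ.m≤n+m l d) d+l<J
    Below⇒< {i} {l} i≤d l≤e (inj₂ e+i<J) = ℕ.≤-<-trans (ℕ.m≤n+m i e) e+i<J , ℕ.≤-<-trans (ℕ.≤-trans l≤e (ℕ.m≤m+n e i)) e+i<J

    ¬Covers⇒Below : ∀ {i l J} → i ≤ J → l ≤ J → ¬ Covers i l J → Below i l J
    ¬Covers⇒Below {i} {l} {J} i≤J l≤J ¬covers with J ℕ.≤? d + l | J ℕ.≤? e + i
    ... | yes J≤d+l | yes J≤e+i = contradiction (i≤J , l≤J , J≤d+l , J≤e+i) ¬covers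
    ... | no  J≰d+l | _         = inj₁ (ℕ.≰⇒> J≰d+l)
    ... | yes _     | no J≰e+i  = inj₂ (ℕ.≰⇒> J≰e+i)

    -- If i′ ≤ i + 1 and l′ ≤ l + 1, the least k covered by (i′, l′) exceeds that of (i, l) by
    -- at most one, so the covered interval cannot jump over an uncovered J.
    Below-step : ∀ {i l i′ l′ J} → i ≤ d → l ≤ e → i′ ≤ suc i → l′ ≤ suc l →
                 ¬ Covers i′ l′ J → Below i l J → Below i′ l′ J
    Below-step i≤d l≤e i′≤1+i l′≤1+l ¬covers below with Below⇒< i≤d l≤e below
    ... | i<J , l<J = ¬Covers⇒Below (ℕ.≤-trans i′≤1+i i<J) (ℕ.≤-trans l′≤1+l l<J) ¬covers

  gap-impossible : ∀ {A B : ℕ → Set} → Convex A → Convex B → (∀ {i} → A i → i ≤ d) → (∀ {l} → B l → l ≤ e) →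
                   ∀ {I J K} → I < J → J < K → (∀ {i l} → A i → B l → ¬ Covers i l J) →
                   ∀ {i₁ l₁ i₂ l₂} → A i₁ → B l₁ → Covers i₁ l₁ I → A i₂ → B l₂ → Covers i₂ l₂ K → ⊥
  gap-impossible {A} {B} convexA convexB A≤d B≤e {I} {J} {K} I<J J<K uncovered
                 {i₁} {l₁} {i₂} {l₂} a₁ b₁ (i₁≤I , l₁≤I , _) a₂ b₂ (_ , _ , K≤d+l₂ , K≤e+i₂)
    with transport convexB (l-step a₂) b₁ b₂ (transport convexA (i-step b₁) a₁ a₂ start)
    where
      start : Below i₁ l₁ J
      start = ¬Covers⇒Below (ℕ.≤-trans i₁≤I (ℕ.<⇒≤ I<J)) (ℕ.≤-trans l₁≤I (ℕ.<⇒≤ I<J)) (uncovered a₁ b₁)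
      i-step : ∀ {l} → B l → ∀ {m} → A m → A (suc m) → Below m l J ⇔ Below (suc m) l J
      i-step b am a1+m = mk⇔ (Below-step (A≤d am) (B≤e b) ℕ.≤-refl (ℕ.n≤1+n _) (uncovered a1+m b))
                             (Below-step (A≤d a1+m) (B≤e b) (ℕ.m≤n⇒m≤1+n (ℕ.n≤1+n _)) (ℕ.n≤1+n _) (uncovered am b))
      l-step : ∀ {i} → A i → ∀ {m} → B m → B (suc m) → Below i m J ⇔ Below i (suc m) J
      l-step a bm b1+m = mk⇔ (Below-step (A≤d a) (B≤e bm) (ℕ.n≤1+n _) ℕ.≤-refl (uncovered a b1+m))
                             (Below-step (A≤d a) (B≤e b1+m) (ℕ.n≤1+n _) (ℕ.m≤n⇒m≤1+n (ℕ.n≤1+n _)) (uncovered a bm))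
  ... | inj₁ d+l₂<J = ℕ.<-asym d+l₂<J (ℕ.<-≤-trans J<K K≤d+l₂)
  ... | inj₂ e+i₂<J = ℕ.<-asym e+i₂<J (ℕ.<-≤-trans J<K K≤e+i₂)

module OrderedField (R : RealField) where

  open RealField R
  open IsCommutativeRing isCommutativeRing
    using (isCommutativeSemiring; +-assoc; +-comm; *-assoc; *-comm; +-identityˡ;
           *-identityˡ; *-identityʳ; zeroˡ; zeroʳ; distribʳ; -‿inverseʳ)
  open IsTotalOrder isTotalOrder using (total; antisym) renaming (refl to ≤-refl; trans to ≤-trans)
  open Poly R using (fromℕ)
  open FiniteSum isCommutativeSemiring public
  open ≡-Reasoning

  commutativeRing : CommutativeRing _ _
  commutativeRing = record { isCommutativeRing = isCommutativeRing }

  open RingProperties (CommutativeRing.ring commutativeRing) using (-‿distribˡ-*; -‿distribʳ-*; -‿involutive)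

  x≤x+y : ∀ x {y} → 0# ≤ y → x ≤ x + y
  x≤x+y x {y} 0≤y = subst₂ _≤_ (+-identityˡ x) (+-comm y x) (+-mono-≤ 0# y x 0≤y)

  x≤y+x : ∀ {y} x → 0# ≤ y → x ≤ y + x
  x≤y+x {y} x 0≤y = subst (_≤ y + x) (+-identityˡ x) (+-mono-≤ 0# y x 0≤y)

  0≤x+y : ∀ {x y} → 0# ≤ x → 0# ≤ y → 0# ≤ x + y
  0≤x+y {x} {y} 0≤x 0≤y = ≤-trans 0≤y (x≤y+x y 0≤x)

  0≤x*x : ∀ x → 0# ≤ x * x
  0≤x*x x with total 0# x
  ... | inj₁ 0≤x = *-nonneg x x 0≤x 0≤x
  ... | inj₂ x≤0 = subst (0# ≤_) -x*-x≡x*x (*-nonneg (- x) (- x) 0≤-x 0≤-x)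
    where
      0≤-x : 0# ≤ - x
      0≤-x = subst₂ _≤_ (-‿inverseʳ x) (+-identityˡ (- x)) (+-mono-≤ x 0# (- x) x≤0)
      -x*-x≡x*x : - x * - x ≡ x * x
      -x*-x≡x*x = begin
        - x * - x     ≡⟨ sym (-‿distribˡ-* x (- x)) ⟩
        - (x * - x)   ≡⟨ cong -_ (sym (-‿distribʳ-* x x)) ⟩
        - (- (x * x)) ≡⟨ -‿involutive (x * x) ⟩
        x * x         ∎

  0≤1 : 0# ≤ 1#
  0≤1 = subst (0# ≤_) (*-identityʳ 1#) (0≤x*x 1#)

  0≤fromℕ : ∀ n → 0# ≤ fromℕ n
  0≤fromℕ zero    = ≤-refl
  0≤fromℕ (suc n) = 0≤x+y 0≤1 (0≤fromℕ n)

  fromℕ≢0 : ∀ {n} → 0 ℕ.< n → fromℕ n ≢ 0#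
  fromℕ≢0 {suc n} _ 1+n≡0 = 0≢1 (antisym 0≤1 (subst (1# ≤_) 1+n≡0 (x≤x+y 1# (0≤fromℕ n))))

  fromℕ-+ : ∀ m n → fromℕ (m ℕ.+ n) ≡ fromℕ m + fromℕ n
  fromℕ-+ zero    n = sym (+-identityˡ _)
  fromℕ-+ (suc m) n = trans (cong (1# +_) (fromℕ-+ m n)) (sym (+-assoc 1# (fromℕ m) (fromℕ n)))

  fromℕ-* : ∀ m n → fromℕ (m ℕ.* n) ≡ fromℕ m * fromℕ n
  fromℕ-* zero    n = sym (zeroˡ _)
  fromℕ-* (suc m) n = begin
    fromℕ (n ℕ.+ m ℕ.* n)               ≡⟨ fromℕ-+ n (m ℕ.* n) ⟩
    fromℕ n + fromℕ (m ℕ.* n)           ≡⟨ cong₂ _+_ (sym (*-identityˡ _)) (fromℕ-* m n) ⟩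
    1# * fromℕ n + fromℕ m * fromℕ n    ≡⟨ sym (distribʳ (fromℕ n) 1# (fromℕ m)) ⟩
    (1# + fromℕ m) * fromℕ n            ∎

  fromℕ-∑ : ∀ n f → fromℕ (Binomial.∑ n f) ≡ ∑[ k < n ] fromℕ (f k)
  fromℕ-∑ zero    f = refl
  fromℕ-∑ (suc n) f = trans (fromℕ-+ (Binomial.∑ n f) (f n)) (cong (_+ fromℕ (f n)) (fromℕ-∑ n f))

  *-≢0 : ∀ {x y} → x ≢ 0# → y ≢ 0# → x * y ≢ 0#
  *-≢0 {x} {y} x≢0 y≢0 xy≡0 with inverse x x≢0
  ... | x⁻¹ , xx⁻¹≡1 = y≢0 (begin
    y              ≡⟨ sym (*-identityˡ y) ⟩
    1# * y         ≡⟨ cong (_* y) (trans (sym xx⁻¹≡1) (*-comm x x⁻¹)) ⟩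
    (x⁻¹ * x) * y  ≡⟨ *-assoc x⁻¹ x y ⟩
    x⁻¹ * (x * y)  ≡⟨ cong (x⁻¹ *_) xy≡0 ⟩
    x⁻¹ * 0#       ≡⟨ zeroʳ x⁻¹ ⟩
    0#             ∎)

  0≤∑ : ∀ n {f} → (∀ k → k ℕ.< n → 0# ≤ f k) → 0# ≤ ∑ n f
  0≤∑ zero    _   = ≤-refl
  0≤∑ (suc n) f≥0 = 0≤x+y (0≤∑ n (λ k k<n → f≥0 k (ℕ.m<n⇒m<1+n k<n))) (f≥0 n ℕ.≤-refl)

  term≤∑ : ∀ n {f} → (∀ k → k ℕ.< n → 0# ≤ f k) → ∀ {j} → j ℕ.< n → f j ≤ ∑ n f
  term≤∑ (suc n) {f} f≥0 {j} j<1+n with ℕ.m<1+n⇒m<n∨m≡n j<1+n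
  ... | inj₁ j<n  = ≤-trans (term≤∑ n (λ k k<n → f≥0 k (ℕ.m<n⇒m<1+n k<n)) j<n) (x≤x+y _ (f≥0 n ℕ.≤-refl))
  ... | inj₂ refl = x≤y+x (f j) (0≤∑ j (λ k k<j → f≥0 k (ℕ.m<n⇒m<1+n k<j)))

  ∑≡0⇒terms≡0 : ∀ n {f} → (∀ k → k ℕ.< n → 0# ≤ f k) → ∑ n f ≡ 0# → ∀ {j} → j ℕ.< n → f j ≡ 0#
  ∑≡0⇒terms≡0 n f≥0 ∑≡0 j<n = antisym (subst (_ ≤_) ∑≡0 (term≤∑ n f≥0 j<n)) (f≥0 _ j<n)

  ∑≢0⇒¬¬term≢0 : ∀ n f → ∑ n f ≢ 0# → ¬ ¬ (Σ ℕ λ k → k ℕ.< n × f k ≢ 0#)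
  ∑≢0⇒¬¬term≢0 zero    f ∑≢0 _        = ∑≢0 refl
  ∑≢0⇒¬¬term≢0 (suc n) f ∑≢0 no-term = ∑≢0⇒¬¬term≢0 n f
    (λ ∑≡0 → no-term (n , ℕ.≤-refl , λ fn≡0 → ∑≢0 (trans (cong₂ _+_ ∑≡0 fn≡0) (+-identityˡ 0#))))
    (λ (k , k<n , fk≢0) → no-term (k , ℕ.m<n⇒m<1+n k<n , fk≢0))

module Polynomial (R : RealField) where

  open RealField R
  open IsCommutativeRing isCommutativeRing using (*-assoc; +-identityˡ; +-identityʳ; *-identityʳ; zeroˡ; distribʳ)
  open Poly R
  open OrderedField R
  open Convex using (Convex)
  open ≡-Reasoning
  open CommutativeSemigroupProperties (CommutativeRing.*-commutativeSemigroup commutativeRing) using (x∙yz≈y∙xz)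
  open import Algebra.Solver.Ring.NaturalCoefficients (CommutativeRing.commutativeSemiring commutativeRing) (λ _ _ → nothing)
    using (solve; _:=_; _:+_; _:*_)

  sumTo≡∑ : ∀ n f → sumTo n f ≡ ∑ n f
  sumTo≡∑ zero    f = refl
  sumTo≡∑ (suc n) f = cong (_+ f n) (sumTo≡∑ n f)

  coeff-> : ∀ {d} (a : Vec Carrier (suc d)) {i} → d ℕ.< i → coeff a i ≡ 0#
  coeff-> {d} a {i} d<i with i ℕ.<? suc d
  ... | yes i<1+d = contradiction (ℕ.≤-pred i<1+d) (ℕ.<⇒≱ d<i)
  ... | no  _     = refl

  noInternalZeros⇒convex : ∀ {d} {w : Vec Carrier (suc d)} → NoInternalZeros w → Convex (λ i → coeff w i ≢ 0#)
  noInternalZeros⇒convex niz {x} {m} {y} wx≢0 wy≢0 x≤m m≤y wm≡0 with ℕ.m≤n⇒m<n∨m≡n x≤m | ℕ.m≤n⇒m<n∨m≡n m≤y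
  ... | inj₂ refl | _         = wx≢0 wm≡0
  ... | _         | inj₂ refl = wy≢0 wm≡0
  ... | inj₁ x<m  | inj₁ m<y  = niz (x , m , y , x<m , m<y , wm≡0 , wx≢0 , wy≢0)

  convolution : (ℕ → Carrier) → (ℕ → Carrier) → ℕ → Carrier
  convolution f g k = ∑[ i < suc k ] (f i * g (k ℕ.∸ i))

  coeff-⊛ : ∀ {d e} (p : Vec Carrier (suc d)) (q : Vec Carrier (suc e)) {k} → k ℕ.< suc (d ℕ.+ e) →
            coeff (p ⊛ q) k ≡ convolution (coeff p) (coeff q) k
  coeff-⊛ {d} {e} p q {k} k<1+d+e with k ℕ.<? suc (d ℕ.+ e)
  ... | no  k≮1+d+e = contradiction k<1+d+e k≮1+d+e
  ... | yes k<1+d+e′ = begin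
    lookup (p ⊛ q) (Fin.fromℕ< k<1+d+e′)
                                                               ≡⟨ lookup∘tabulate (λ t → sumTo (suc (Fin.toℕ t)) (term (Fin.toℕ t))) (Fin.fromℕ< k<1+d+e′) ⟩
    sumTo (suc (Fin.toℕ (Fin.fromℕ< k<1+d+e′))) (term (Fin.toℕ (Fin.fromℕ< k<1+d+e′)))
                                                               ≡⟨ cong (λ t → sumTo (suc t) (term t)) (toℕ-fromℕ< k<1+d+e′) ⟩
    sumTo (suc k) (term k)                                     ≡⟨ sumTo≡∑ (suc k) (term k) ⟩
    convolution (coeff p) (coeff q) k                          ∎
    where
      term : ℕ → ℕ → Carrier
      term t i = coeff p i * coeff q (t ℕ.∸ i)

  ∑-powers-suc : ∀ n (f : ℕ → Carrier) x → ∑[ i < suc (suc n) ] (f i * x ^ i) ≡ f 0 + x * ∑[ i < suc n ] (f (suc i) * x ^ i)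
  ∑-powers-suc n f x = begin
    ∑[ i < suc (suc n) ] (f i * x ^ i)                 ≡⟨ ∑-head (suc n) (λ i → f i * x ^ i) ⟩
    f 0 * 1# + ∑[ i < suc n ] (f (suc i) * (x * x ^ i))
      ≡⟨ cong₂ _+_ (*-identityʳ (f 0)) (∑-cong (suc n) (λ i _ → x∙yz≈y∙xz (f (suc i)) x (x ^ i))) ⟩
    f 0 + ∑[ i < suc n ] (x * (f (suc i) * x ^ i))     ≡⟨ cong (f 0 +_) (sym (*-distribˡ-∑ (suc n) x _)) ⟩
    f 0 + x * ∑[ i < suc n ] (f (suc i) * x ^ i)       ∎

  ∑-convolution-powers : ∀ m n (f g : ℕ → Carrier) x → (∀ i → m ℕ.< i → f i ≡ 0#) → (∀ j → n ℕ.< j → g j ≡ 0#) →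
    ∑[ k < suc (m ℕ.+ n) ] (convolution f g k * x ^ k) ≡ ∑[ i < suc m ] (f i * x ^ i) * ∑[ j < suc n ] (g j * x ^ j)
  ∑-convolution-powers zero n f g x f>0≡0 _ = begin
    ∑[ k < suc n ] (convolution f g k * x ^ k)
      ≡⟨ ∑-cong (suc n) (λ k _ → trans (cong (_* x ^ k) (convolution-head k)) (*-assoc (f 0) (g k) (x ^ k))) ⟩
    ∑[ k < suc n ] (f 0 * (g k * x ^ k))      ≡⟨ sym (*-distribˡ-∑ (suc n) (f 0) _) ⟩
    f 0 * G                                    ≡⟨ cong (_* G) (sym (trans (+-identityˡ _) (*-identityʳ (f 0)))) ⟩
    ∑[ i < 1 ] (f i * x ^ i) * G               ∎
    where
      G : Carrier
      G = ∑[ j < suc n ] (g j * x ^ j)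
      convolution-head : ∀ k → convolution f g k ≡ f 0 * g k
      convolution-head k = begin
        convolution f g k                                           ≡⟨ ∑-head k (λ i → f i * g (k ℕ.∸ i)) ⟩
        f 0 * g k + ∑[ i < k ] (f (suc i) * g (k ℕ.∸ suc i))
          ≡⟨ cong (f 0 * g k +_) (∑-zero k (λ i _ → trans (cong (_* _) (f>0≡0 (suc i) (s≤s z≤n))) (zeroˡ _))) ⟩
        f 0 * g k + 0#                                              ≡⟨ +-identityʳ _ ⟩
        f 0 * g k                                                   ∎
  ∑-convolution-powers (suc m) n f g x f>1+m≡0 g>n≡0 = begin
    ∑[ k < suc (suc (m ℕ.+ n)) ] (convolution f g k * x ^ k)              ≡⟨ ∑-powers-suc (m ℕ.+ n) (convolution f g) x ⟩
    convolution f g 0 + x * ∑[ k < suc (m ℕ.+ n) ] (convolution f g (suc k) * x ^ k)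
                                                                         ≡⟨ cong₂ (λ a b → a + x * b) (+-identityˡ _) tail ⟩
    f 0 * g 0 + x * (f 0 * P + F′ * G)                                   ≡⟨ cong (λ y → f 0 * g 0 + x * (f 0 * P + F′ * y)) G≡g0+xP ⟩
    f 0 * g 0 + x * (f 0 * P + F′ * (g 0 + x * P))                       ≡⟨ regroup (f 0) (g 0) x P F′ ⟩
    (f 0 + x * F′) * (g 0 + x * P)                                       ≡⟨ cong₂ _*_ (sym (∑-powers-suc m f x)) (sym G≡g0+xP) ⟩
    ∑[ i < suc (suc m) ] (f i * x ^ i) * G                               ∎
    where
      G P F′ : Carrier
      G  = ∑[ j < suc n ] (g j * x ^ j)
      P  = ∑[ j < suc (m ℕ.+ n) ] (g (suc j) * x ^ j)
      F′ = ∑[ i < suc m ] (f (suc i) * x ^ i)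
      G≡g0+xP : G ≡ g 0 + x * P
      G≡g0+xP = trans (sym (∑-truncate (suc n) (suc (suc (m ℕ.+ n))) _ (λ j n<j → trans (cong (_* x ^ j) (g>n≡0 j n<j)) (zeroˡ _))
                                       (s≤s (ℕ.m≤n⇒m≤o+n (suc m) ℕ.≤-refl))))
                      (∑-powers-suc (m ℕ.+ n) g x)
      tail : ∑[ k < suc (m ℕ.+ n) ] (convolution f g (suc k) * x ^ k) ≡ f 0 * P + F′ * G
      tail = begin
        ∑[ k < suc (m ℕ.+ n) ] (convolution f g (suc k) * x ^ k)
          ≡⟨ ∑-cong (suc (m ℕ.+ n)) (λ k _ → trans (cong (_* x ^ k) (∑-head (suc k) (λ i → f i * g (suc k ℕ.∸ i))))
                                                 (distribʳ (x ^ k) _ _)) ⟩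
        ∑[ k < suc (m ℕ.+ n) ] (f 0 * g (suc k) * x ^ k + convolution (f ∘ suc) g k * x ^ k)
          ≡⟨ ∑-distrib-+ (suc (m ℕ.+ n)) (λ k → f 0 * g (suc k) * x ^ k) (λ k → convolution (f ∘ suc) g k * x ^ k) ⟩
        ∑[ k < suc (m ℕ.+ n) ] (f 0 * g (suc k) * x ^ k) + ∑[ k < suc (m ℕ.+ n) ] (convolution (f ∘ suc) g k * x ^ k)
          ≡⟨ cong₂ _+_ (trans (∑-cong (suc (m ℕ.+ n)) (λ k _ → *-assoc (f 0) _ _)) (sym (*-distribˡ-∑ (suc (m ℕ.+ n)) (f 0) _)))
                       (∑-convolution-powers m n (f ∘ suc) g x (λ i m<i → f>1+m≡0 (suc i) (s≤s m<i)) g>n≡0) ⟩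
        f 0 * P + F′ * G ∎
      regroup : ∀ a b x p f → a * b + x * (a * p + f * (b + x * p)) ≡ (a + x * f) * (b + x * p)
      regroup = solve 5 (λ a b x p f → a :* b :+ x :* (a :* p :+ f :* (b :+ x :* p)) := (a :+ x :* f) :* (b :+ x :* p)) refl

  evalℕ-⊛ : ∀ {d e} (p : Vec Carrier (suc d)) (q : Vec Carrier (suc e)) n → evalℕ (p ⊛ q) n ≡ evalℕ p n * evalℕ q n
  evalℕ-⊛ {d} {e} p q n = begin
    evalℕ (p ⊛ q) n                                                   ≡⟨ sumTo≡∑ (suc (d ℕ.+ e)) _ ⟩
    ∑[ k < suc (d ℕ.+ e) ] (coeff (p ⊛ q) k * x ^ k)                   ≡⟨ ∑-cong (suc (d ℕ.+ e)) (λ k k< → cong (_* x ^ k) (coeff-⊛ p q k<)) ⟩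
    ∑[ k < suc (d ℕ.+ e) ] (convolution (coeff p) (coeff q) k * x ^ k)
      ≡⟨ ∑-convolution-powers d e (coeff p) (coeff q) x (λ i → coeff-> p) (λ j → coeff-> q) ⟩
    ∑[ i < suc d ] (coeff p i * x ^ i) * ∑[ j < suc e ] (coeff q j * x ^ j) ≡⟨ sym (cong₂ _*_ (sumTo≡∑ (suc d) _) (sumTo≡∑ (suc e) _)) ⟩
    evalℕ p n * evalℕ q n                                             ∎
    where
      x : Carrier
      x = fromℕ n

module WBasis (R : RealField) where

  open RealField R
  open IsCommutativeRing isCommutativeRing using (+-identityʳ; *-identityʳ)
  open Poly R
  open OrderedField R
  open Binomial using (binomial; binomial≡C; basisValue; productCoefficient; basisProduct)
  open RingProperties (CommutativeRing.ring commutativeRing) using (+-cancelˡ)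
  open ≡-Reasoning

  -- IsW d p w says p(n) = ∑_{k ≤ n} w_k · basis d n k. For k > n, truncated subtraction makes
  -- basis D n k equal to 1, not 0, so it is only used for k ≤ n.
  basis : ℕ → ℕ → ℕ → Carrier
  basis D n k = fromℕ (((n ℕ.∸ k) ℕ.+ D) C D)

  basis≡basisValue : ∀ D n k → basis D n k ≡ fromℕ (basisValue D n k)
  basis≡basisValue D n k = cong fromℕ (sym (trans (binomial≡C _ D) (cong (_C D) (ℕ.+-comm D (n ℕ.∸ k)))))

  basis-diag : ∀ D n → basis D n n ≡ 1#
  basis-diag D n = trans (cong (λ m → fromℕ ((m ℕ.+ D) C D)) (ℕ.n∸n≡0 n)) (trans (cong fromℕ (nCn≡1 D)) (+-identityʳ 1#))

  basis-product : ∀ {d e i l n} → i ℕ.≤ d → l ℕ.≤ e → i ℕ.≤ n → l ℕ.≤ n →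
    basis d n i * basis e n l ≡ ∑[ k < suc n ] (fromℕ (productCoefficient (d ℕ.∸ i) i (e ℕ.∸ l) l k) * basis (d ℕ.+ e) n k)
  basis-product {d} {e} {i} {l} {n} i≤d l≤e i≤n l≤n = begin
    basis d n i * basis e n l
      ≡⟨ cong₂ _*_ (basis≡basisValue d n i) (basis≡basisValue e n l) ⟩
    fromℕ (basisValue d n i) * fromℕ (basisValue e n l)
      ≡⟨ sym (fromℕ-* (basisValue d n i) (basisValue e n l)) ⟩
    fromℕ (basisValue d n i ℕ.* basisValue e n l)
      ≡⟨ cong fromℕ (cong₂ ℕ._*_ (basisValue≡ i≤d i≤n) (basisValue≡ l≤e l≤n)) ⟩
    fromℕ (binomial ((d ℕ.∸ i) ℕ.+ n) (i ℕ.+ (d ℕ.∸ i)) ℕ.* binomial ((e ℕ.∸ l) ℕ.+ n) (l ℕ.+ (e ℕ.∸ l)))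
      ≡⟨ cong fromℕ (basisProduct (d ℕ.∸ i) i (e ℕ.∸ l) l n) ⟩
    fromℕ (Binomial.∑ (suc n) (λ k → c k ℕ.* basisValue D′ n k))
      ≡⟨ fromℕ-∑ (suc n) _ ⟩
    ∑[ k < suc n ] fromℕ (c k ℕ.* basisValue D′ n k)
      ≡⟨ ∑-cong (suc n) (λ k _ → trans (fromℕ-* (c k) _) (cong (fromℕ (c k) *_) (sym (basis≡basisValue′ k)))) ⟩
    ∑[ k < suc n ] (fromℕ (c k) * basis (d ℕ.+ e) n k) ∎
    where
      c : ℕ → ℕ
      c = productCoefficient (d ℕ.∸ i) i (e ℕ.∸ l) l
      D′ : ℕ
      D′ = (l ℕ.+ (e ℕ.∸ l)) ℕ.+ (i ℕ.+ (d ℕ.∸ i))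
      D′≡d+e : D′ ≡ d ℕ.+ e
      D′≡d+e = trans (cong₂ ℕ._+_ (ℕ.m+[n∸m]≡n l≤e) (ℕ.m+[n∸m]≡n i≤d)) (ℕ.+-comm e d)
      basis≡basisValue′ : ∀ k → basis (d ℕ.+ e) n k ≡ fromℕ (basisValue D′ n k)
      basis≡basisValue′ k = trans (basis≡basisValue (d ℕ.+ e) n k) (cong (λ D → fromℕ (basisValue D n k)) (sym D′≡d+e))
      basisValue≡ : ∀ {d i} → i ℕ.≤ d → i ℕ.≤ n → basisValue d n i ≡ binomial ((d ℕ.∸ i) ℕ.+ n) (i ℕ.+ (d ℕ.∸ i))
      basisValue≡ {d} {i} i≤d i≤n = sym (cong₂ binomial (begin
        (d ℕ.∸ i) ℕ.+ n                 ≡⟨ cong ((d ℕ.∸ i) ℕ.+_) (sym (ℕ.m+[n∸m]≡n i≤n)) ⟩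
        (d ℕ.∸ i) ℕ.+ (i ℕ.+ (n ℕ.∸ i)) ≡⟨ sym (ℕ.+-assoc (d ℕ.∸ i) i (n ℕ.∸ i)) ⟩
        ((d ℕ.∸ i) ℕ.+ i) ℕ.+ (n ℕ.∸ i) ≡⟨ cong (ℕ._+ (n ℕ.∸ i)) (ℕ.m∸n+n≡m i≤d) ⟩
        d ℕ.+ (n ℕ.∸ i)                 ∎) (ℕ.m+[n∸m]≡n i≤d))

  -- The basis is unitriangular, so the expansion determines the coefficients.
  coefficients-unique : ∀ D (u v : ℕ → Carrier) →
    (∀ n → ∑[ k < suc n ] (u k * basis D n k) ≡ ∑[ k < suc n ] (v k * basis D n k)) → ∀ k → u k ≡ v k
  coefficients-unique D u v expansions-agree k = agree-below (suc k) ℕ.≤-refl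
    where
      agree-below : ∀ n {k} → k ℕ.< n → u k ≡ v k
      agree-below (suc n) {k} k<1+n with ℕ.m<1+n⇒m<n∨m≡n k<1+n
      ... | inj₁ k<n  = agree-below n k<n
      ... | inj₂ refl = begin
        u k                  ≡⟨ sym (trans (cong (u k *_) (basis-diag D k)) (*-identityʳ (u k))) ⟩
        u k * basis D k k    ≡⟨ +-cancelˡ (∑[ j < k ] (u j * basis D k j)) _ _ (begin
          ∑[ j < k ] (u j * basis D k j) + u k * basis D k k ≡⟨ expansions-agree k ⟩
          ∑[ j < suc k ] (v j * basis D k j)
            ≡⟨ cong (_+ v k * basis D k k) (sym (∑-cong k (λ j j<k → cong (_* basis D k j) (agree-below k j<k)))) ⟩
          ∑[ j < k ] (u j * basis D k j) + v k * basis D k k ∎) ⟩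
        v k * basis D k k    ≡⟨ trans (cong (v k *_) (basis-diag D k)) (*-identityʳ (v k)) ⟩
        v k                  ∎

module WProduct (R : RealField) {d e : ℕ}
                (wp : Vec (RealField.Carrier R) (suc d)) (wq : Vec (RealField.Carrier R) (suc e)) where

  open RealField R
  open IsCommutativeRing isCommutativeRing using (*-assoc; zeroˡ; zeroʳ)
  open Poly R
  open OrderedField R
  open Polynomial R using (coeff->; noInternalZeros⇒convex; sumTo≡∑; evalℕ-⊛)
  open WBasis R
  open Binomial using (productCoefficient; productCoefficient-<ˡ; productCoefficient-<ʳ)
  open Covering d e using (Covers; productCoefficient>0⇒Covers; Covers⇒productCoefficient>0; gap-impossible)
  open CommutativeSemigroupProperties (CommutativeRing.*-commutativeSemigroup commutativeRing) using (interchange)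
  open ≡-Reasoning

  a b : ℕ → Carrier
  a = coeff wp
  b = coeff wq

  term : ℕ → ℕ → ℕ → Carrier
  term i l k = a i * b l * fromℕ (productCoefficient (d ℕ.∸ i) i (e ℕ.∸ l) l k)

  productW : ℕ → Carrier
  productW k = ∑[ i < suc k ] ∑[ l < suc k ] term i l k

  term-<ˡ : ∀ {i} l {k} → k ℕ.< i → term i l k ≡ 0#
  term-<ˡ {i} l k<i = trans (cong (λ c → a i * b l * fromℕ c) (productCoefficient-<ˡ (d ℕ.∸ i) (e ℕ.∸ l) l k<i)) (zeroʳ _)

  term-<ʳ : ∀ i {l k} → k ℕ.< l → term i l k ≡ 0#
  term-<ʳ i {l} k<l = trans (cong (λ c → a i * b l * fromℕ c) (productCoefficient-<ʳ (d ℕ.∸ i) i (e ℕ.∸ l) k<l)) (zeroʳ _)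

  expansion-product : ∀ n → ∑[ i < suc n ] (a i * basis d n i) * ∑[ l < suc n ] (b l * basis e n l)
                          ≡ ∑[ k < suc n ] (productW k * basis (d ℕ.+ e) n k)
  expansion-product n = begin
    ∑[ i < suc n ] (a i * basis d n i) * ∑[ l < suc n ] (b l * basis e n l)
      ≡⟨ ∑*∑ (suc n) (suc n) _ _ ⟩
    ∑[ i < suc n ] ∑[ l < suc n ] (a i * basis d n i * (b l * basis e n l))
      ≡⟨ ∑-cong (suc n) (λ i i≤n → ∑-cong (suc n) (λ l l≤n → pair (ℕ.≤-pred i≤n) (ℕ.≤-pred l≤n))) ⟩
    ∑[ i < suc n ] ∑[ l < suc n ] ∑[ k < suc n ] (term i l k * basis (d ℕ.+ e) n k)
      ≡⟨ trans (∑-cong (suc n) (λ i _ → ∑-comm (suc n) (suc n) _)) (∑-comm (suc n) (suc n) _) ⟩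
    ∑[ k < suc n ] ∑[ i < suc n ] ∑[ l < suc n ] (term i l k * basis (d ℕ.+ e) n k)
      ≡⟨ ∑-cong (suc n) (λ k _ → trans (∑-cong (suc n) (λ i _ → sym (*-distribʳ-∑ (suc n) _ _)))
                                       (sym (*-distribʳ-∑ (suc n) _ _))) ⟩
    ∑[ k < suc n ] (∑[ i < suc n ] ∑[ l < suc n ] term i l k * basis (d ℕ.+ e) n k)
      ≡⟨ ∑-cong (suc n) (λ k k≤n → cong (_* basis (d ℕ.+ e) n k) (truncate k≤n)) ⟩
    ∑[ k < suc n ] (productW k * basis (d ℕ.+ e) n k) ∎
    where
      both-vanish : ∀ {i l} → a i * b l ≡ 0# →
                    a i * basis d n i * (b l * basis e n l) ≡ ∑[ k < suc n ] (term i l k * basis (d ℕ.+ e) n k)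
      both-vanish {i} {l} ab≡0 = begin
        a i * basis d n i * (b l * basis e n l) ≡⟨ interchange (a i) (basis d n i) (b l) (basis e n l) ⟩
        a i * b l * (basis d n i * basis e n l) ≡⟨ trans (cong (_* (basis d n i * basis e n l)) ab≡0) (zeroˡ _) ⟩
        0#                                      ≡⟨ sym (∑-zero (suc n) vanish) ⟩
        ∑[ k < suc n ] (term i l k * basis (d ℕ.+ e) n k) ∎
        where
          vanish : ∀ k → k ℕ.< suc n → term i l k * basis (d ℕ.+ e) n k ≡ 0#
          vanish k _ = begin
            a i * b l * fromℕ (productCoefficient (d ℕ.∸ i) i (e ℕ.∸ l) l k) * basis (d ℕ.+ e) n k
              ≡⟨ cong (λ x → x * fromℕ (productCoefficient (d ℕ.∸ i) i (e ℕ.∸ l) l k) * basis (d ℕ.+ e) n k) ab≡0 ⟩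
            0# * fromℕ (productCoefficient (d ℕ.∸ i) i (e ℕ.∸ l) l k) * basis (d ℕ.+ e) n k
              ≡⟨ trans (cong (_* basis (d ℕ.+ e) n k) (zeroˡ _)) (zeroˡ _) ⟩
            0# ∎
      pair : ∀ {i l} → i ℕ.≤ n → l ℕ.≤ n →
             a i * basis d n i * (b l * basis e n l) ≡ ∑[ k < suc n ] (term i l k * basis (d ℕ.+ e) n k)
      pair {i} {l} i≤n l≤n with i ℕ.≤? d | l ℕ.≤? e
      ... | yes i≤d | yes l≤e = begin
        a i * basis d n i * (b l * basis e n l)   ≡⟨ interchange (a i) (basis d n i) (b l) (basis e n l) ⟩
        a i * b l * (basis d n i * basis e n l)   ≡⟨ cong (a i * b l *_) (basis-product i≤d l≤e i≤n l≤n) ⟩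
        a i * b l * ∑[ k < suc n ] (fromℕ (productCoefficient (d ℕ.∸ i) i (e ℕ.∸ l) l k) * basis (d ℕ.+ e) n k)
                                                  ≡⟨ *-distribˡ-∑ (suc n) _ _ ⟩
        ∑[ k < suc n ] (a i * b l * (fromℕ (productCoefficient (d ℕ.∸ i) i (e ℕ.∸ l) l k) * basis (d ℕ.+ e) n k))
                                                  ≡⟨ ∑-cong (suc n) (λ k _ → sym (*-assoc (a i * b l) _ _)) ⟩
        ∑[ k < suc n ] (term i l k * basis (d ℕ.+ e) n k) ∎
      ... | no i≰d | _      = both-vanish {i} {l} (trans (cong (_* b l) (coeff-> wp (ℕ.≰⇒> i≰d))) (zeroˡ _))
      ... | yes _  | no l≰e = both-vanish {i} {l} (trans (cong (a i *_) (coeff-> wq (ℕ.≰⇒> l≰e))) (zeroʳ _))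
      truncate : ∀ {k} → k ℕ.< suc n → ∑[ i < suc n ] ∑[ l < suc n ] term i l k ≡ productW k
      truncate {k} k<1+n = trans
        (∑-truncate (suc k) (suc n) _ (λ i k<i → ∑-zero (suc n) (λ l _ → term-<ˡ l k<i)) k<1+n)
        (∑-cong (suc k) (λ i _ → ∑-truncate (suc k) (suc n) _ (λ l k<l → term-<ʳ i k<l) k<1+n))

  IsW-⊛ : ∀ {p : Vec Carrier (suc d)} {q : Vec Carrier (suc e)} {w : Vec Carrier (suc (d ℕ.+ e))} →
          IsW d p wp → IsW e q wq → IsW (d ℕ.+ e) (p ⊛ q) w → ∀ k → coeff w k ≡ productW k
  IsW-⊛ {p} {q} {w} isWp isWq isW = coefficients-unique (d ℕ.+ e) (coeff w) productW expansions
    where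
      expansions : ∀ n → ∑[ k < suc n ] (coeff w k * basis (d ℕ.+ e) n k) ≡ ∑[ k < suc n ] (productW k * basis (d ℕ.+ e) n k)
      expansions n = begin
        ∑[ k < suc n ] (coeff w k * basis (d ℕ.+ e) n k)  ≡⟨ sym (trans (isW n) (sumTo≡∑ (suc n) _)) ⟩
        evalℕ (p ⊛ q) n                                   ≡⟨ evalℕ-⊛ p q n ⟩
        evalℕ p n * evalℕ q n                             ≡⟨ cong₂ _*_ (trans (isWp n) (sumTo≡∑ (suc n) _)) (trans (isWq n) (sumTo≡∑ (suc n) _)) ⟩
        ∑[ i < suc n ] (a i * basis d n i) * ∑[ l < suc n ] (b l * basis e n l) ≡⟨ expansion-product n ⟩
        ∑[ k < suc n ] (productW k * basis (d ℕ.+ e) n k) ∎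

  a≢0⇒≤d : ∀ {i} → a i ≢ 0# → i ℕ.≤ d
  a≢0⇒≤d {i} ai≢0 with i ℕ.≤? d
  ... | yes i≤d = i≤d
  ... | no  i≰d = contradiction (coeff-> wp (ℕ.≰⇒> i≰d)) ai≢0

  b≢0⇒≤e : ∀ {l} → b l ≢ 0# → l ℕ.≤ e
  b≢0⇒≤e {l} bl≢0 with l ℕ.≤? e
  ... | yes l≤e = l≤e
  ... | no  l≰e = contradiction (coeff-> wq (ℕ.≰⇒> l≰e)) bl≢0

  term≢0⇒ : ∀ i l k → term i l k ≢ 0# → a i ≢ 0# × b l ≢ 0# × Covers i l k
  term≢0⇒ i l k t≢0 = ai≢0 , bl≢0 , productCoefficient>0⇒Covers (a≢0⇒≤d ai≢0) (b≢0⇒≤e bl≢0) (ℕ.n≢0⇒n>0 c≢0)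
    where
      c : ℕ
      c = productCoefficient (d ℕ.∸ i) i (e ℕ.∸ l) l k
      ai≢0 : a i ≢ 0#
      ai≢0 ai≡0 = t≢0 (trans (cong (λ x → x * b l * fromℕ c) ai≡0) (trans (cong (_* fromℕ c) (zeroˡ _)) (zeroˡ _)))
      bl≢0 : b l ≢ 0#
      bl≢0 bl≡0 = t≢0 (trans (cong (λ x → a i * x * fromℕ c) bl≡0) (trans (cong (_* fromℕ c) (zeroʳ _)) (zeroˡ _)))
      c≢0 : c ≢ 0
      c≢0 c≡0 = t≢0 (trans (cong (λ x → a i * b l * fromℕ x) c≡0) (zeroʳ _))

  term≢0 : ∀ i l k → a i ≢ 0# → b l ≢ 0# → Covers i l k → term i l k ≢ 0#
  term≢0 i l k ai≢0 bl≢0 covers =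
    *-≢0 (*-≢0 ai≢0 bl≢0) (fromℕ≢0 (Covers⇒productCoefficient>0 (a≢0⇒≤d ai≢0) (b≢0⇒≤e bl≢0) covers))

  productW≢0⇒¬¬term≢0 : ∀ k → productW k ≢ 0# → ¬ ¬ (Σ ℕ λ i → Σ ℕ λ l → term i l k ≢ 0#)
  productW≢0⇒¬¬term≢0 k w≢0 no-term =
    ∑≢0⇒¬¬term≢0 (suc k) (λ i → ∑[ l < suc k ] term i l k) w≢0 λ (i , _ , rowᵢ≢0) →
    ∑≢0⇒¬¬term≢0 (suc k) (λ l → term i l k) rowᵢ≢0 λ (l , _ , t≢0) → no-term (i , l , t≢0)

  productW≡0⇒term≡0 : Nonnegative wp → Nonnegative wq → ∀ k → productW k ≡ 0# → ∀ i l → term i l k ≡ 0#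
  productW≡0⇒term≡0 wp≥0 wq≥0 k w≡0 i l with i ℕ.≤? k | l ℕ.≤? k
  ... | no  i≰k | _       = term-<ˡ l (ℕ.≰⇒> i≰k)
  ... | yes _   | no  l≰k = term-<ʳ i (ℕ.≰⇒> l≰k)
  ... | yes i≤k | yes l≤k =
    ∑≡0⇒terms≡0 (suc k) {λ l → term i l k} (λ l _ → 0≤term i l)
      (∑≡0⇒terms≡0 (suc k) {λ i → ∑[ l < suc k ] term i l k} (λ i _ → 0≤∑ (suc k) (λ l _ → 0≤term i l)) w≡0 (s≤s i≤k))
      (s≤s l≤k)
    where
      0≤term : ∀ i l → 0# ≤ term i l k
      0≤term i l = *-nonneg _ _ (*-nonneg _ _ (wp≥0 i) (wq≥0 l)) (0≤fromℕ (productCoefficient (d ℕ.∸ i) i (e ℕ.∸ l) l k))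

  productW-noInternalZeros : Nonnegative wp → Nonnegative wq → NoInternalZeros wp → NoInternalZeros wq →
    ∀ {I J K} → I ℕ.< J → J ℕ.< K → productW J ≡ 0# → productW I ≢ 0# → productW K ≢ 0# → ⊥
  productW-noInternalZeros wp≥0 wq≥0 wp-niz wq-niz {I} {J} {K} I<J J<K wJ≡0 wI≢0 wK≢0 =
    productW≢0⇒¬¬term≢0 I wI≢0 λ (i₁ , l₁ , t₁≢0) →
    productW≢0⇒¬¬term≢0 K wK≢0 λ (i₂ , l₂ , t₂≢0) →
    let a₁ , b₁ , covers₁ = term≢0⇒ i₁ l₁ I t₁≢0
        a₂ , b₂ , covers₂ = term≢0⇒ i₂ l₂ K t₂≢0
    in gap-impossible (noInternalZeros⇒convex wp-niz) (noInternalZeros⇒convex wq-niz) a≢0⇒≤d b≢0⇒≤e I<J J<K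
         (λ {i} {l} ai≢0 bl≢0 covers → term≢0 i l J ai≢0 bl≢0 covers (productW≡0⇒term≡0 wp≥0 wq≥0 J wJ≡0 i l))
         a₁ b₁ covers₁ a₂ b₂ covers₂

open import Data.Nat using (_+_)
open RealField using (Carrier)
open Poly

proposition4p4 : (R : RealField) (d e : ℕ)
    (p : Vec (Carrier R) (suc d)) (q : Vec (Carrier R) (suc e)) →
    HasDegree R d p → HasDegree R e q →
    (wp : Vec (Carrier R) (suc d)) → IsW R d p wp → Nonnegative R wp → NoInternalZeros R wp →
    (wq : Vec (Carrier R) (suc e)) → IsW R e q wq → Nonnegative R wq → NoInternalZeros R wq →
    (w : Vec (Carrier R) (suc (d + e))) → IsW R (d + e) (_⊛_ R p q) w → NoInternalZeros R w
proposition4p4 R d e p q _ _ wp isWp wp≥0 wp-niz wq isWq wq≥0 wq-niz w isW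
               (I , J , K , I<J , J<K , wJ≡0 , wI≢0 , wK≢0) =
  productW-noInternalZeros wp≥0 wq≥0 wp-niz wq-niz I<J J<K
    (trans (sym (w≡productW J)) wJ≡0) (wI≢0 ∘ trans (w≡productW I)) (wK≢0 ∘ trans (w≡productW K))
  where
    open WProduct R wp wq using (productW; IsW-⊛; productW-noInternalZeros)
    w≡productW : ∀ k → coeff R w k ≡ productW k
    w≡productW = IsW-⊛ isWp isWq isW
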